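{- Let $d<n$ be positive integers with $d$ odd, and let $N=2^n$ and $D=\binom{n}{d}$. Then $\mathrm{cng}(Q_n^d)\le \frac{nN}{D}$.
   Context: $Q_n^d$ is the graph on vertex set $\{0,1\}^n$ in which $x,y$ are adjacent iff their Hamming distance (number of coordinates in which they differ) is exactly $d$. For a graph $G$, with $\mathcal{P}_{x,y}$ the set of paths between $x$ and $y$ and $\mathcal{P}$ the set of all paths, an A-flow is a function $\varphi:\mathcal{P}\to\mathbb{R}_{\ge0}$ with $\sum_{P\in\mathcal{P}_{x,y}}\varphi(P)=1$ for all distinct $x,y$; the congestion of an edge $e$ is $\sum_{P\ni e}\varphi(P)$, $\mathrm{cng}(\varphi)$ is the maximum edge congestion, and $\mathrm{cng}(G)=\min_\varphi\mathrm{cng}(\varphi)$ over all A-flows $\varphi$ on $G$. -}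

module Defs where

open import Data.Nat as ℕ using (ℕ; zero; suc)
open import Data.Bool using (Bool; true; false; if_then_else_; _∧_; _∨_; _xor_)
import Data.Bool.Properties as BoolP
open import Data.Vec using (Vec; []; _∷_)
open import Data.Vec.Properties using (≡-dec)
open import Data.List using (List; []; _∷_; head; last)
open import Data.List.Relation.Unary.All using (All)
open import Data.List.Relation.Unary.Linked using (Linked)
open import Data.List.Relation.Unary.Unique.Propositional using (Unique)
open import Data.Maybe using (Maybe; just; nothing)
open import Data.Product using (_×_; _,_)
open import Data.Integer using (+_)
open import Data.Rational using (ℚ; 0ℚ; 1ℚ; _+_; _≤_; _/_)
open import Relation.Binary.PropositionalEquality using (_≡_; _≢_)
open import Relation.Nullary.Decidable using (⌊_⌋)

Vertex : ℕ → Set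
Vertex n = Vec Bool n

hamming : ∀ {n} → Vertex n → Vertex n → ℕ
hamming []      []      = 0
hamming (a ∷ x) (b ∷ y) = (if a xor b then 1 else 0) ℕ.+ hamming x y

Adj : ∀ {n} → ℕ → Vertex n → Vertex n → Set
Adj d x y = hamming x y ≡ d

eqV : ∀ {n} → Vertex n → Vertex n → Bool
eqV x y = ⌊ ≡-dec BoolP._≟_ x y ⌋

-- A path in Q_n^d, given by its vertex sequence: nonempty, consecutive
-- vertices adjacent, all vertices distinct.  A list and its reverse
-- describe the same (undirected) path.
IsPath : ∀ {n} → ℕ → List (Vertex n) → Set
IsPath d []        = Data.Bool.T false
IsPath d (v ∷ vs)  = Linked (Adj d) (v ∷ vs) × Unique (v ∷ vs)

endsAt : ∀ {n} → Vertex n → Vertex n → List (Vertex n) → Bool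
endsAt x y P with head P | last P
... | just a | just b = (eqV a x ∧ eqV b y) ∨ (eqV a y ∧ eqV b x)
... | _      | _      = false

usesEdge : ∀ {n} → Vertex n → Vertex n → List (Vertex n) → Bool
usesEdge u v (a ∷ b ∷ vs) =
  ((eqV a u ∧ eqV b v) ∨ (eqV a v ∧ eqV b u)) ∨ usesEdge u v (b ∷ vs)
usesEdge u v _ = false

-- A (finitely supported) path weighting: phi(P) is the total weight of
-- the entries representing P (as P or its reverse).
Flow : ℕ → Set
Flow n = List (List (Vertex n) × ℚ)

weightOf : ∀ {n} → (List (Vertex n) → Bool) → Flow n → ℚ
weightOf p []             = 0ℚ
weightOf p ((P , w) ∷ φ)  = (if p P then w else 0ℚ) + weightOf p φ

IsAFlow : ∀ {n} → ℕ → Flow n → Set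
IsAFlow {n} d φ =
  All (λ e → IsPath d (Data.Product.proj₁ e) × 0ℚ ≤ Data.Product.proj₂ e) φ
  × (∀ (x y : Vertex n) → x ≢ y → weightOf (endsAt x y) φ ≡ 1ℚ)

congestion : ∀ {n} → Vertex n → Vertex n → Flow n → ℚ
congestion u v φ = weightOf (usesEdge u v) φ

CngAtMost : ∀ {n} → ℕ → Flow n → ℚ → Set
CngAtMost {n} d φ B = ∀ (u v : Vertex n) → Adj d u v → congestion u v φ ≤ B

ℕtoℚ : ℕ → ℚ
ℕtoℚ k = + k / 1

-- a / b as a rational (b = 0 never occurs below; value 0 then by convention)
_/ℕ_ : ℕ → ℕ → ℚ
a /ℕ zero  = 0ℚ
a /ℕ suc b = + a / suc b

{-# OPTIONS --safe #-}
-- The vectors of weight d span 𝔽₂ⁿ when d is odd and d < n: every z is a sum of at most n of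
-- them.  (An even-weight vector splits into pairs of coordinates, and a pair is the sum of two
-- weight-d vectors sharing d - 1 coordinates outside it; an odd-weight vector is one weight-d
-- vector away from an even-weight vector of weight < n.)  For every start x, permutation π of
-- the coordinates and offset z, walk from x adding the π-images of the letters of the word for
-- z, and erase loops: this is a path from x to x ⊕ π z.  Each route gets weight 1/(2·n!), so
-- every pair {x, y} receives total weight 1, since for each π exactly one z leads from x to y
-- and one from y to x.  A step along the edge {u, v} adds the letter u ⊕ v; summed over the
-- start x (by translation) each letter equal to u ⊕ v is counted at most twice, and summed over
-- π each letter of weight d is moved onto u ⊕ v by exactly d!(n-d)! permutations.  Words have
-- at most n letters, so the congestion is at most 2·2ⁿ·n·d!(n-d)!/(2·n!) = n2ⁿ/C(n,d).
module Submission where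

import Algebra.Properties.CommutativeSemigroup as CommSemigroupₚ
open import Data.Bool as Bool using (Bool; true; false; not; _∧_; _∨_; _xor_; if_then_else_; f≤t; b≤b)
import Data.Bool.Properties as Boolₚ
open import Data.Empty using (⊥-elim)
open import Data.Fin using (Fin; zero; suc)
open import Data.Integer as ℤ using (+≤+)
open import Data.Integer.Properties using (pos-+; pos-*)
open import Data.List using (List; []; _∷_; _++_; map; length; cartesianProduct; foldr; allFin; tabulate; head; last)
open import Data.List.Properties using (length-++; length-map; length-tabulate; map-tabulate)
open import Data.List.Relation.Unary.All as All using (All; []; _∷_)
open import Data.List.Relation.Unary.All.Properties using (++⁺; map⁺)
open import Data.List.Relation.Unary.All.Properties.Core using (¬Any⇒All¬)
open import Data.List.Relation.Unary.AllPairs using ([]; _∷_)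
open import Data.List.Relation.Unary.Any using (here; there)
open import Data.List.Relation.Unary.Linked as Linked using (Linked; []; [-]; _∷_; _∷′_)
open import Data.List.Relation.Unary.Unique.Propositional using (Unique)
open import Data.Maybe using (just)
open import Data.Maybe.Relation.Binary.Connected using (Connected; just)
open import Data.Nat using (ℕ; zero; suc; pred; _+_; _*_; _∸_; _^_; _!; _%_; _≤_; _<_; z≤n; s≤s; _≤?_; parity)
open import Data.Nat.Combinatorics using (_C_; nCk≡n!/k![n-k]!; k![n∸k]!∣n!)
open import Data.Nat.DivMod using (m/n*n≡m)
open import Data.Nat.Properties
open import Data.Nat.Tactic.RingSolver using (solve-∀)
open import Data.Parity as ℙ using (0ℙ; 1ℙ)
import Data.Parity.Properties as ℙₚ
open import Data.Product using (Σ; ∃₂; Σ-syntax; _×_; _,_; proj₁; proj₂)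
open import Data.Rational using (ℚ; 0ℚ; 1ℚ; _/_; toℚᵘ) renaming (_+_ to _+ℚ_; _≤_ to _≤ℚ_)
import Data.Rational.Properties as ℚₚ
open import Data.Rational.Properties
  using (toℚᵘ-injective; toℚᵘ-cancel-≤; toℚᵘ-fromℚᵘ; toℚᵘ-homo-+; 0/n≡0; nonNegative⁻¹; normalize-nonNeg)
open import Data.Rational.Unnormalised as ℚᵘ using (mkℚᵘ; *≡*; *≤*)
import Data.Rational.Unnormalised.Properties as ℚᵘₚ
open import Data.Unit using (⊤; tt)
open import Data.Vec as Vec using (Vec; []; _∷_; zipWith; replicate; lookup; insertAt; removeAt)
open import Data.Vec.Properties
  using (zipWith-assoc; zipWith-comm; zipWith-identityˡ; zipWith-identityʳ; ≡-dec; insertAt-lookup; removeAt-insertAt;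
         insertAt-removeAt)
open import Data.Vec.Relation.Binary.Pointwise.Inductive as Pointwise using (Pointwise; []; _∷_)
open import Function using (_∘_)
open import Function.Bundles using (mk⇔)
open import Relation.Binary.Definitions using (DecidableEquality)
open import Relation.Binary.PropositionalEquality
open import Relation.Nullary using (Dec; yes; no; does; _×-dec_)
open import Relation.Nullary.Decidable using (dec-false; does-⇔; isYes≗does)

open import Defs

module +-CS = CommSemigroupₚ +-commutativeSemigroup
module *-CS = CommSemigroupₚ *-commutativeSemigroup

private variable
  A B X : Set
  n : ℕ

∑ : List A → (A → ℕ) → ℕ
∑ []       f = 0
∑ (x ∷ xs) f = f x + ∑ xs f

∑-syntax : List A → (A → ℕ) → ℕ
∑-syntax = ∑

infixl 10 ∑-syntax
syntax ∑-syntax xs (λ x → e) = ∑[ x ∈ xs ] e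

∑-++ : ∀ (xs ys : List A) f → ∑ (xs ++ ys) f ≡ ∑ xs f + ∑ ys f
∑-++ []       ys f = refl
∑-++ (x ∷ xs) ys f = trans (cong (f x +_) (∑-++ xs ys f)) (sym (+-assoc (f x) _ _))

∑-map : ∀ (g : A → B) xs f → ∑ (map g xs) f ≡ ∑ xs (f ∘ g)
∑-map g []       f = refl
∑-map g (x ∷ xs) f = cong (f (g x) +_) (∑-map g xs f)

∑-cartesianProduct : ∀ (xs : List A) (ys : List B) f →
  ∑ (cartesianProduct xs ys) f ≡ ∑[ x ∈ xs ] ∑[ y ∈ ys ] f (x , y)
∑-cartesianProduct []       ys f = refl
∑-cartesianProduct (x ∷ xs) ys f = begin
  ∑ (map (x ,_) ys ++ cartesianProduct xs ys) f
    ≡⟨ ∑-++ (map (x ,_) ys) _ f ⟩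
  ∑ (map (x ,_) ys) f + ∑ (cartesianProduct xs ys) f
    ≡⟨ cong₂ _+_ (∑-map (x ,_) ys f) (∑-cartesianProduct xs ys f) ⟩
  ∑ ys (λ y → f (x , y)) + ∑[ x′ ∈ xs ] ∑[ y ∈ ys ] f (x′ , y) ∎
  where open ≡-Reasoning

∑-cong : ∀ (xs : List A) {f g} → (∀ x → f x ≡ g x) → ∑ xs f ≡ ∑ xs g
∑-cong []       f≗g = refl
∑-cong (x ∷ xs) f≗g = cong₂ _+_ (f≗g x) (∑-cong xs f≗g)

∑-mono-≤ : ∀ (xs : List A) {f g} → (∀ x → f x ≤ g x) → ∑ xs f ≤ ∑ xs g
∑-mono-≤ []       f≤g = z≤n
∑-mono-≤ (x ∷ xs) f≤g = +-mono-≤ (f≤g x) (∑-mono-≤ xs f≤g)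

∑-distrib-+ : ∀ (xs : List A) f g → ∑[ x ∈ xs ] (f x + g x) ≡ ∑ xs f + ∑ xs g
∑-distrib-+ []       f g = refl
∑-distrib-+ (x ∷ xs) f g =
  trans (cong (f x + g x +_) (∑-distrib-+ xs f g)) (+-CS.interchange (f x) (g x) (∑ xs f) (∑ xs g))

∑-distribˡ-* : ∀ (xs : List A) c f → ∑[ x ∈ xs ] (c * f x) ≡ c * ∑ xs f
∑-distribˡ-* []       c f = sym (*-zeroʳ c)
∑-distribˡ-* (x ∷ xs) c f =
  trans (cong (c * f x +_) (∑-distribˡ-* xs c f)) (sym (*-distribˡ-+ c (f x) (∑ xs f)))

∑-zero : ∀ (xs : List A) → ∑[ x ∈ xs ] 0 ≡ 0
∑-zero []       = refl
∑-zero (x ∷ xs) = ∑-zero xs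

∑-comm : ∀ (xs : List A) (ys : List B) (f : A → B → ℕ) →
  ∑[ x ∈ xs ] ∑[ y ∈ ys ] f x y ≡ ∑[ y ∈ ys ] ∑[ x ∈ xs ] f x y
∑-comm []       ys f = sym (∑-zero ys)
∑-comm (x ∷ xs) ys f =
  trans (cong (∑ ys (f x) +_) (∑-comm xs ys f)) (sym (∑-distrib-+ ys (f x) (λ y → ∑[ x′ ∈ xs ] f x′ y)))

∑-rotate : ∀ (xs : List A) (ys : List B) (zs : List X) (f : A → B → X → ℕ) →
  ∑[ x ∈ xs ] ∑[ y ∈ ys ] ∑[ z ∈ zs ] f x y z ≡ ∑[ y ∈ ys ] ∑[ z ∈ zs ] ∑[ x ∈ xs ] f x y z
∑-rotate xs ys zs f =
  trans (∑-comm xs ys (λ x y → ∑[ z ∈ zs ] f x y z)) (∑-cong ys (λ y → ∑-comm xs zs (λ x z → f x y z)))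

∑-const : ∀ (xs : List A) c → ∑[ x ∈ xs ] c ≡ length xs * c
∑-const []       c = refl
∑-const (x ∷ xs) c = cong (c +_) (∑-const xs c)

length-cartesianProduct : ∀ (xs : List A) (ys : List B) →
  length (cartesianProduct xs ys) ≡ length xs * length ys
length-cartesianProduct []       ys = refl
length-cartesianProduct (x ∷ xs) ys = trans (length-++ (map (x ,_) ys))
  (cong₂ _+_ (length-map (x ,_) ys) (length-cartesianProduct xs ys))

𝟙 : Bool → ℕ
𝟙 b = if b then 1 else 0

𝟙≤1 : ∀ b → 𝟙 b ≤ 1
𝟙≤1 true  = ≤-refl
𝟙≤1 false = z≤n

𝟙-∧ : ∀ a b → 𝟙 (a ∧ b) ≡ 𝟙 a * 𝟙 b
𝟙-∧ true  b = sym (+-identityʳ (𝟙 b))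
𝟙-∧ false b = refl

𝟙-∨ : ∀ a b → 𝟙 (a ∨ b) ≤ 𝟙 a + 𝟙 b
𝟙-∨ true  b = s≤s z≤n
𝟙-∨ false b = ≤-refl

𝟙-∨-∧ : ∀ a b c d → a ∧ c ≡ false → 𝟙 ((a ∧ b) ∨ (c ∧ d)) ≡ 𝟙 a * 𝟙 b + 𝟙 c * 𝟙 d
𝟙-∨-∧ false b c     d _  = 𝟙-∧ c d
𝟙-∨-∧ true  true  false d _ = refl
𝟙-∨-∧ true  false false d _ = refl

count : Bool → Vec Bool n → ℕ
count b []      = 0
count b (c ∷ v) = 𝟙 (does (b Bool.≟ c)) + count b v

wt : Vec Bool n → ℕ
wt = count true

infixl 6 _⊕_
_⊕_ : Vec Bool n → Vec Bool n → Vec Bool n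
_⊕_ = zipWith _xor_

0ᵥ : Vec Bool n
0ᵥ = replicate _ false

∁ : Vec Bool n → Vec Bool n
∁ = Vec.map not

⨁ : List (Vec Bool n) → Vec Bool n
⨁ = foldr _⊕_ 0ᵥ

⊕-assoc : ∀ (x y z : Vec Bool n) → x ⊕ y ⊕ z ≡ x ⊕ (y ⊕ z)
⊕-assoc = zipWith-assoc Boolₚ.xor-assoc

⊕-comm : ∀ (x y : Vec Bool n) → x ⊕ y ≡ y ⊕ x
⊕-comm = zipWith-comm Boolₚ.xor-comm

⊕-identityˡ : ∀ (x : Vec Bool n) → 0ᵥ ⊕ x ≡ x
⊕-identityˡ = zipWith-identityˡ Boolₚ.xor-identityˡ

⊕-identityʳ : ∀ (x : Vec Bool n) → x ⊕ 0ᵥ ≡ x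
⊕-identityʳ = zipWith-identityʳ Boolₚ.xor-identityʳ

⊕-self : ∀ (x : Vec Bool n) → x ⊕ x ≡ 0ᵥ
⊕-self []      = refl
⊕-self (b ∷ x) = cong₂ _∷_ (Boolₚ.xor-same b) (⊕-self x)

⊕-cancelˡ : ∀ (x y : Vec Bool n) → x ⊕ (x ⊕ y) ≡ y
⊕-cancelˡ x y = begin
  x ⊕ (x ⊕ y) ≡⟨ ⊕-assoc x x y ⟨
  x ⊕ x ⊕ y   ≡⟨ cong (_⊕ y) (⊕-self x) ⟩
  0ᵥ ⊕ y      ≡⟨ ⊕-identityˡ y ⟩
  y           ∎
  where open ≡-Reasoning

⊕-cancelʳ : ∀ (x y : Vec Bool n) → x ⊕ y ⊕ y ≡ x
⊕-cancelʳ x y = trans (⊕-assoc x y y) (trans (cong (x ⊕_) (⊕-self y)) (⊕-identityʳ x))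

⨁-++ : ∀ (xs ys : List (Vec Bool n)) → ⨁ (xs ++ ys) ≡ ⨁ xs ⊕ ⨁ ys
⨁-++ []       ys = sym (⊕-identityˡ (⨁ ys))
⨁-++ (x ∷ xs) ys = trans (cong (x ⊕_) (⨁-++ xs ys)) (sym (⊕-assoc x (⨁ xs) (⨁ ys)))

hamming≡wt⊕ : ∀ (x y : Vec Bool n) → hamming x y ≡ wt (x ⊕ y)
hamming≡wt⊕ []      []      = refl
hamming≡wt⊕ (a ∷ x) (b ∷ y) = cong₂ _+_ (indicator (a xor b)) (hamming≡wt⊕ x y)
  where
  indicator : ∀ c → (if c then 1 else 0) ≡ 𝟙 (does (true Bool.≟ c))
  indicator true  = refl
  indicator false = refl

wt-∁ : ∀ (v : Vec Bool n) → wt (∁ v) + wt v ≡ n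
wt-∁ []          = refl
wt-∁ (true ∷ v)  = trans (+-suc (wt (∁ v)) (wt v)) (cong suc (wt-∁ v))
wt-∁ (false ∷ v) = cong suc (wt-∁ v)

wt-∁≡count-false : ∀ (v : Vec Bool n) → wt (∁ v) ≡ count false v
wt-∁≡count-false []          = refl
wt-∁≡count-false (true ∷ v)  = wt-∁≡count-false v
wt-∁≡count-false (false ∷ v) = cong suc (wt-∁≡count-false v)

count-false≡n∸wt : ∀ (v : Vec Bool n) → count false v ≡ n ∸ wt v
count-false≡n∸wt {n} v = begin
  count false v               ≡⟨ m+n∸n≡m (count false v) (wt v) ⟨
  count false v + wt v ∸ wt v ≡⟨ cong (λ k → k + wt v ∸ wt v) (wt-∁≡count-false v) ⟨
  wt (∁ v) + wt v ∸ wt v      ≡⟨ cong (_∸ wt v) (wt-∁ v) ⟩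
  n ∸ wt v                    ∎
  where open ≡-Reasoning

wt≤n : ∀ (v : Vec Bool n) → wt v ≤ n
wt≤n {n} v = subst (wt v ≤_) (wt-∁ v) (m≤n+m (wt v) (wt (∁ v)))

wt≡0⇒≡0ᵥ : ∀ (v : Vec Bool n) → wt v ≡ 0 → v ≡ 0ᵥ
wt≡0⇒≡0ᵥ []          _  = refl
wt≡0⇒≡0ᵥ (false ∷ v) wv = cong (false ∷_) (wt≡0⇒≡0ᵥ v wv)

infix 4 _⊆_
_⊆_ : Vec Bool n → Vec Bool n → Set
_⊆_ = Pointwise Bool._≤_

⊆-trans : ∀ {u v w : Vec Bool n} → u ⊆ v → v ⊆ w → u ⊆ w
⊆-trans = Pointwise.trans Boolₚ.≤-trans

⊆-∁ : ∀ {u v : Vec Bool n} → u ⊆ ∁ v → v ⊆ ∁ u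
⊆-∁ {u = []}    {[]}        []         = []
⊆-∁ {u = _ ∷ _} {true ∷ _}  (b≤b ∷ u⊆) = b≤b ∷ ⊆-∁ u⊆
⊆-∁ {u = _ ∷ _} {false ∷ _} (f≤t ∷ u⊆) = f≤t ∷ ⊆-∁ u⊆
⊆-∁ {u = _ ∷ _} {false ∷ _} (b≤b ∷ u⊆) = b≤b ∷ ⊆-∁ u⊆

⊕-⊆ : ∀ {u v : Vec Bool n} → u ⊆ v → v ⊕ u ⊆ v
⊕-⊆ []                 = []
⊕-⊆ (f≤t ∷ u⊆)         = b≤b ∷ ⊕-⊆ u⊆
⊕-⊆ (b≤b {true} ∷ u⊆)  = f≤t ∷ ⊕-⊆ u⊆
⊕-⊆ (b≤b {false} ∷ u⊆) = b≤b ∷ ⊕-⊆ u⊆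

wt-⊕-⊆ : ∀ {u v : Vec Bool n} → u ⊆ v → wt (v ⊕ u) + wt u ≡ wt v
wt-⊕-⊆ []                 = refl
wt-⊕-⊆ (f≤t ∷ u⊆)         = cong suc (wt-⊕-⊆ u⊆)
wt-⊕-⊆ {u = _ ∷ u} {_ ∷ v} (b≤b {true} ∷ u⊆) =
  trans (+-suc (wt (v ⊕ u)) (wt u)) (cong suc (wt-⊕-⊆ u⊆))
wt-⊕-⊆ (b≤b {false} ∷ u⊆) = wt-⊕-⊆ u⊆

wt-⊕-disjoint : ∀ {u v : Vec Bool n} → u ⊆ ∁ v → wt (u ⊕ v) ≡ wt u + wt v
wt-⊕-disjoint {u = []}    {[]}            []         = refl
wt-⊕-disjoint {u = _ ∷ _} {true ∷ v}      (b≤b ∷ u⊆) =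
  trans (cong suc (wt-⊕-disjoint u⊆)) (sym (+-suc _ (wt v)))
wt-⊕-disjoint {u = _ ∷ _} {false ∷ _}     (f≤t ∷ u⊆) = wt-⊕-disjoint u⊆
wt-⊕-disjoint {u = _ ∷ _} {false ∷ _}     (b≤b ∷ u⊆) = cong suc (wt-⊕-disjoint u⊆)

subvector : ∀ k (v : Vec Bool n) → k ≤ wt v → Σ[ u ∈ Vec Bool n ] u ⊆ v × wt u ≡ k
subvector zero    []          _         = [] , [] , refl
subvector k       (false ∷ v) k≤        with subvector k v k≤
... | u , u⊆ , wu = false ∷ u , b≤b ∷ u⊆ , wu
subvector zero    (true ∷ v)  _         with subvector zero v z≤n
... | u , u⊆ , wu = false ∷ u , f≤t ∷ u⊆ , wu
subvector (suc k) (true ∷ v)  (s≤s k≤) with subvector k v k≤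
... | u , u⊆ , wu = true ∷ u , b≤b ∷ u⊆ , cong suc wu

-- Words in the vectors of weight d

parity-cancelʳ : ∀ m k {l} → m + k ≡ l → parity k ≡ parity l → parity m ≡ 0ℙ
parity-cancelʳ m k {l} m+k≡l pk≡pl = ℙₚ.+-cancelʳ-≡ (parity k) (parity m) 0ℙ (begin
  parity m ℙ.+ parity k ≡⟨ ℙₚ.+-homo-+ m k ⟨
  parity (m + k)        ≡⟨ cong parity m+k≡l ⟩
  parity l              ≡⟨ pk≡pl ⟨
  parity k              ∎)
  where open ≡-Reasoning

record Word (d : ℕ) (z : Vec Bool n) : Set where
  field
    letters    : List (Vec Bool n)
    letters-wt : All (λ g → wt g ≡ d) letters
    ⨁-letters  : ⨁ letters ≡ z

open Word

module _ {d : ℕ} where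

  ε : Word d (0ᵥ {n})
  ε = record { letters = [] ; letters-wt = [] ; ⨁-letters = refl }

  [_]ʷ : ∀ {g : Vec Bool n} → wt g ≡ d → Word d g
  [_]ʷ {g = g} wg = record { letters = g ∷ [] ; letters-wt = wg ∷ [] ; ⨁-letters = ⊕-identityʳ g }

  infixr 5 _·_
  _·_ : ∀ {x y : Vec Bool n} → Word d x → Word d y → Word d (x ⊕ y)
  u · w = record
    { letters    = letters u ++ letters w
    ; letters-wt = ++⁺ (letters-wt u) (letters-wt w)
    ; ⨁-letters  = trans (⨁-++ (letters u) (letters w)) (cong₂ _⊕_ (⨁-letters u) (⨁-letters w))
    }

  castʷ : ∀ {x y : Vec Bool n} → x ≡ y → Word d x → Word d y
  castʷ x≡y w = record { letters = letters w ; letters-wt = letters-wt w ; ⨁-letters = trans (⨁-letters w) x≡y }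

module Words {n d : ℕ} (0<d : 0 < d) (d<n : d < n) (d-odd : parity d ≡ 1ℙ) where

  -- g and h share d - 1 coordinates outside p, and each contains one of the two coordinates of p.
  split-weight-two : ∀ {p : Vec Bool n} → wt p ≡ 2 → ∃₂ λ g h → wt g ≡ d × wt h ≡ d × g ⊕ h ≡ p
  split-weight-two {p} wp with subvector 1 p (subst (1 ≤_) (sym wp) (s≤s z≤n))
                             | subvector (d ∸ 1) (∁ p) room-outside-p
    where
    room-outside-p : d ∸ 1 ≤ wt (∁ p)
    room-outside-p = +-cancelʳ-≤ 2 (d ∸ 1) (wt (∁ p)) (begin
      d ∸ 1 + 2         ≡⟨ +-comm (d ∸ 1) 2 ⟩
      suc (suc (d ∸ 1)) ≡⟨ cong suc (m+[n∸m]≡n 0<d) ⟩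
      suc d             ≤⟨ d<n ⟩
      n                 ≡⟨ trans (cong (wt (∁ p) +_) (sym wp)) (wt-∁ p) ⟨
      wt (∁ p) + 2      ∎)
      where open ≤-Reasoning
  ... | q , q⊆p , wq | r , r⊆∁p , wr =
    q ⊕ r , p ⊕ q ⊕ r , wt-⊕r q⊆p wq , wt-⊕r (⊕-⊆ q⊆p) wt-p⊕q , ⊕≡p
    where
    wt-⊕r : ∀ {q′} → q′ ⊆ p → wt q′ ≡ 1 → wt (q′ ⊕ r) ≡ d
    wt-⊕r q′⊆p wq′ = trans (wt-⊕-disjoint (⊆-trans q′⊆p (⊆-∁ r⊆∁p)))
                           (trans (cong₂ _+_ wq′ wr) (m+[n∸m]≡n 0<d))
    wt-p⊕q : wt (p ⊕ q) ≡ 1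
    wt-p⊕q = +-cancelʳ-≡ 1 (wt (p ⊕ q)) 1 (trans (cong (wt (p ⊕ q) +_) (sym wq)) (trans (wt-⊕-⊆ q⊆p) wp))
    ⊕≡p : q ⊕ r ⊕ (p ⊕ q ⊕ r) ≡ p
    ⊕≡p = begin
      q ⊕ r ⊕ (p ⊕ q ⊕ r)     ≡⟨ cong (q ⊕ r ⊕_) (⊕-comm (p ⊕ q) r) ⟩
      q ⊕ r ⊕ (r ⊕ (p ⊕ q))   ≡⟨ ⊕-assoc q r (r ⊕ (p ⊕ q)) ⟩
      q ⊕ (r ⊕ (r ⊕ (p ⊕ q))) ≡⟨ cong (q ⊕_) (⊕-cancelˡ r (p ⊕ q)) ⟩
      q ⊕ (p ⊕ q)             ≡⟨ cong (q ⊕_) (⊕-comm p q) ⟩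
      q ⊕ (q ⊕ p)             ≡⟨ ⊕-cancelˡ q p ⟩
      p                       ∎
      where open ≡-Reasoning

  evenWord : ∀ k (z : Vec Bool n) → wt z ≡ k → parity k ≡ 0ℙ → Σ[ w ∈ Word d z ] length (letters w) ≡ k
  evenWord zero          z wz _  = castʷ (sym (wt≡0⇒≡0ᵥ z wz)) ε , refl
  evenWord (suc zero)    z wz ()
  evenWord (suc (suc k)) z wz pk with subvector 2 z (subst (2 ≤_) (sym wz) (s≤s (s≤s z≤n)))
  ... | p , p⊆z , wp with split-weight-two wp | evenWord k (z ⊕ p) wt-rest pk
    where
    wt-rest : wt (z ⊕ p) ≡ k
    wt-rest = +-cancelʳ-≡ 2 (wt (z ⊕ p)) k
      (trans (cong (wt (z ⊕ p) +_) (sym wp)) (trans (wt-⊕-⊆ p⊆z) (trans wz (+-comm 2 k))))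
  ... | g , h , wg , wh , g⊕h≡p | w , |w|≡k =
    castʷ (trans (cong (_⊕ (z ⊕ p)) g⊕h≡p) (trans (cong (p ⊕_) (⊕-comm z p)) (⊕-cancelˡ p z)))
      (([ wg ]ʷ · [ wh ]ʷ) · w) ,
    cong (2 +_) |w|≡k

  split-odd : ∀ (z : Vec Bool n) → parity (wt z) ≡ 1ℙ →
    ∃₂ λ g r → wt g ≡ d × g ⊕ r ≡ z × parity (wt r) ≡ 0ℙ × wt r < n
  split-odd z pz with d ≤? wt z
  ... | yes d≤wz with subvector d z d≤wz
  ...   | g , g⊆z , wg =
    g , z ⊕ g , wg , g⊕r≡z , parity-cancelʳ (wt (z ⊕ g)) d wr+d≡wz (trans d-odd (sym pz)) , wr<n
    where
    wr+d≡wz : wt (z ⊕ g) + d ≡ wt z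
    wr+d≡wz = trans (cong (wt (z ⊕ g) +_) (sym wg)) (wt-⊕-⊆ g⊆z)
    g⊕r≡z : g ⊕ (z ⊕ g) ≡ z
    g⊕r≡z = trans (cong (g ⊕_) (⊕-comm z g)) (⊕-cancelˡ g z)
    wr<n : wt (z ⊕ g) < n
    wr<n = begin-strict
      wt (z ⊕ g)     <⟨ m<m+n (wt (z ⊕ g)) 0<d ⟩
      wt (z ⊕ g) + d ≡⟨ wr+d≡wz ⟩
      wt z           ≤⟨ wt≤n z ⟩
      n              ∎
      where open ≤-Reasoning
  split-odd z pz | no d≰wz with subvector (d ∸ wt z) (∁ z) room-outside-z
    where
    room-outside-z : d ∸ wt z ≤ wt (∁ z)
    room-outside-z = begin
      d ∸ wt z ≤⟨ ∸-monoˡ-≤ (wt z) (<⇒≤ d<n) ⟩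
      n ∸ wt z ≡⟨ cong (_∸ wt z) (wt-∁ z) ⟨
      wt (∁ z) + wt z ∸ wt z ≡⟨ m+n∸n≡m (wt (∁ z)) (wt z) ⟩
      wt (∁ z) ∎
      where open ≤-Reasoning
  ... | s , s⊆∁z , ws =
    z ⊕ s , s , wg , ⊕-cancelʳ z s , parity-cancelʳ (wt s) (wt z) ws+wz≡d (trans pz (sym d-odd)) , ws<n
    where
    wz≤d : wt z ≤ d
    wz≤d = <⇒≤ (≰⇒> d≰wz)
    wg : wt (z ⊕ s) ≡ d
    wg = trans (wt-⊕-disjoint (⊆-∁ s⊆∁z)) (trans (cong (wt z +_) ws) (m+[n∸m]≡n wz≤d))
    ws+wz≡d : wt s + wt z ≡ d
    ws+wz≡d = trans (+-comm (wt s) (wt z)) (trans (sym (wt-⊕-disjoint (⊆-∁ s⊆∁z))) wg)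
    ws<n : wt s < n
    ws<n = begin-strict
      wt s     ≡⟨ ws ⟩
      d ∸ wt z ≤⟨ m∸n≤m d (wt z) ⟩
      d        <⟨ d<n ⟩
      n        ∎
      where open ≤-Reasoning

  word : ∀ (z : Vec Bool n) → Σ[ w ∈ Word d z ] length (letters w) ≤ n
  word z with parity (wt z) in pz
  ... | 0ℙ = let w , |w|≡wz = evenWord (wt z) z refl pz in w , subst (_≤ n) (sym |w|≡wz) (wt≤n z)
  ... | 1ℙ = let g , r , wg , g⊕r≡z , pr , wr<n = split-odd z pz
                 w , |w|≡wr = evenWord (wt r) r refl pr
             in castʷ g⊕r≡z ([ wg ]ʷ · w) , subst (λ k → suc k ≤ n) (sym |w|≡wr) wr<n

vertices : ∀ n → List (Vec Bool n)
vertices zero    = [] ∷ []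
vertices (suc n) = map (true ∷_) (vertices n) ++ map (false ∷_) (vertices n)

length-vertices : ∀ n → length (vertices n) ≡ 2 ^ n
length-vertices zero    = refl
length-vertices (suc n) = begin
  length (map (true ∷_) (vertices n) ++ map (false ∷_) (vertices n))
    ≡⟨ length-++ (map (true ∷_) (vertices n)) ⟩
  length (map (true ∷_) (vertices n)) + length (map (false ∷_) (vertices n))
    ≡⟨ cong₂ _+_ (length-map (true ∷_) (vertices n)) (length-map (false ∷_) (vertices n)) ⟩
  length (vertices n) + length (vertices n)
    ≡⟨ cong₂ _+_ (length-vertices n) (trans (length-vertices n) (sym (+-identityʳ (2 ^ n)))) ⟩
  2 ^ n + (2 ^ n + 0) ∎
  where open ≡-Reasoning

∑-vertices : ∀ (f : Vec Bool (suc n) → ℕ) →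
  ∑ (vertices (suc n)) f ≡ ∑[ v ∈ vertices n ] f (true ∷ v) + ∑[ v ∈ vertices n ] f (false ∷ v)
∑-vertices {n} f = trans (∑-++ (map (true ∷_) (vertices n)) _ f)
  (cong₂ _+_ (∑-map (true ∷_) (vertices n) f) (∑-map (false ∷_) (vertices n) f))

∑-translate : ∀ (c : Vec Bool n) (f : Vec Bool n → ℕ) → ∑[ v ∈ vertices n ] f (v ⊕ c) ≡ ∑ (vertices n) f
∑-translate []          f = refl
∑-translate (true ∷ c)  f = begin
  ∑ (vertices (suc _)) (λ v → f (v ⊕ (true ∷ c)))
    ≡⟨ ∑-vertices (λ v → f (v ⊕ (true ∷ c))) ⟩
  ∑[ v ∈ vertices _ ] f (false ∷ v ⊕ c) + ∑[ v ∈ vertices _ ] f (true ∷ v ⊕ c)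
    ≡⟨ cong₂ _+_ (∑-translate c (f ∘ (false ∷_))) (∑-translate c (f ∘ (true ∷_))) ⟩
  ∑[ v ∈ vertices _ ] f (false ∷ v) + ∑[ v ∈ vertices _ ] f (true ∷ v)
    ≡⟨ +-comm (∑[ v ∈ vertices _ ] f (false ∷ v)) _ ⟩
  ∑[ v ∈ vertices _ ] f (true ∷ v) + ∑[ v ∈ vertices _ ] f (false ∷ v)
    ≡⟨ ∑-vertices f ⟨
  ∑ (vertices (suc _)) f ∎
  where open ≡-Reasoning
∑-translate (false ∷ c) f = begin
  ∑ (vertices (suc _)) (λ v → f (v ⊕ (false ∷ c)))
    ≡⟨ ∑-vertices (λ v → f (v ⊕ (false ∷ c))) ⟩
  ∑[ v ∈ vertices _ ] f (true ∷ v ⊕ c) + ∑[ v ∈ vertices _ ] f (false ∷ v ⊕ c)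
    ≡⟨ cong₂ _+_ (∑-translate c (f ∘ (true ∷_))) (∑-translate c (f ∘ (false ∷_))) ⟩
  ∑[ v ∈ vertices _ ] f (true ∷ v) + ∑[ v ∈ vertices _ ] f (false ∷ v)
    ≡⟨ ∑-vertices f ⟨
  ∑ (vertices (suc _)) f ∎
  where open ≡-Reasoning

eqV≡does : ∀ (v c : Vec Bool n) → eqV v c ≡ does (≡-dec Bool._≟_ v c)
eqV≡does v c = isYes≗does (≡-dec Bool._≟_ v c)

eqV-≢ : ∀ {v c : Vec Bool n} → v ≢ c → eqV v c ≡ false
eqV-≢ {v = v} {c} v≢c = trans (eqV≡does v c) (dec-false (≡-dec Bool._≟_ v c) v≢c)

eqV-∷ : ∀ a b (v c : Vec Bool n) → eqV (a ∷ v) (b ∷ c) ≡ does (a Bool.≟ b) ∧ eqV v c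
eqV-∷ a b v c = trans (eqV≡does (a ∷ v) (b ∷ c)) (cong (does (a Bool.≟ b) ∧_) (sym (eqV≡does v c)))

∑-eqV : ∀ (c : Vec Bool n) → ∑[ v ∈ vertices n ] 𝟙 (eqV v c) ≡ 1
∑-eqV         []      = refl
∑-eqV {suc n} (b ∷ c) = begin
  ∑ (vertices (suc n)) (λ v → 𝟙 (eqV v (b ∷ c)))
    ≡⟨ ∑-vertices (λ v → 𝟙 (eqV v (b ∷ c))) ⟩
  ∑[ v ∈ vertices n ] 𝟙 (eqV (true ∷ v) (b ∷ c)) + ∑[ v ∈ vertices n ] 𝟙 (eqV (false ∷ v) (b ∷ c))
    ≡⟨ cong₂ _+_ (∑-cong (vertices n) (λ v → cong 𝟙 (eqV-∷ true b v c)))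
                 (∑-cong (vertices n) (λ v → cong 𝟙 (eqV-∷ false b v c))) ⟩
  ∑[ v ∈ vertices n ] 𝟙 (does (true Bool.≟ b) ∧ eqV v c)
    + ∑[ v ∈ vertices n ] 𝟙 (does (false Bool.≟ b) ∧ eqV v c)
    ≡⟨ exactly-one b ⟩
  1 ∎
  where
  open ≡-Reasoning
  exactly-one : ∀ b → ∑[ v ∈ vertices n ] 𝟙 (does (true Bool.≟ b) ∧ eqV v c)
                    + ∑[ v ∈ vertices n ] 𝟙 (does (false Bool.≟ b) ∧ eqV v c) ≡ 1
  exactly-one true  = cong₂ _+_ (∑-eqV c) (∑-zero (vertices n))
  exactly-one false = cong₂ _+_ (∑-zero (vertices n)) (∑-eqV c)

eqV-* : ∀ (v c : Vec Bool n) (f : Vec Bool n → ℕ) → 𝟙 (eqV v c) * f v ≡ f c * 𝟙 (eqV v c)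
eqV-* v c f with ≡-dec Bool._≟_ v c
... | yes refl = *-comm 1 (f v)
... | no  _    = sym (*-zeroʳ (f c))

∑-pick : ∀ (c : Vec Bool n) (f : Vec Bool n → ℕ) → ∑[ v ∈ vertices n ] (𝟙 (eqV v c) * f v) ≡ f c
∑-pick {n} c f = begin
  ∑[ v ∈ vertices n ] (𝟙 (eqV v c) * f v) ≡⟨ ∑-cong (vertices n) (λ v → eqV-* v c f) ⟩
  ∑[ v ∈ vertices n ] (f c * 𝟙 (eqV v c)) ≡⟨ ∑-distribˡ-* (vertices n) (f c) _ ⟩
  f c * ∑[ v ∈ vertices n ] 𝟙 (eqV v c)   ≡⟨ cong (f c *_) (∑-eqV c) ⟩
  f c * 1                                 ≡⟨ *-identityʳ (f c) ⟩
  f c                                     ∎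
  where open ≡-Reasoning

eqV-⊕ : ∀ (a g b : Vec Bool n) → eqV (a ⊕ g) b ≡ eqV g (a ⊕ b)
eqV-⊕ a g b = begin
  eqV (a ⊕ g) b
    ≡⟨ eqV≡does (a ⊕ g) b ⟩
  does (≡-dec Bool._≟_ (a ⊕ g) b)
    ≡⟨ does-⇔ (mk⇔ to from) (≡-dec Bool._≟_ (a ⊕ g) b) (≡-dec Bool._≟_ g (a ⊕ b)) ⟩
  does (≡-dec Bool._≟_ g (a ⊕ b))
    ≡⟨ eqV≡does g (a ⊕ b) ⟨
  eqV g (a ⊕ b) ∎
  where
  open ≡-Reasoning
  to : a ⊕ g ≡ b → g ≡ a ⊕ b
  to refl = sym (⊕-cancelˡ a g)
  from : g ≡ a ⊕ b → a ⊕ g ≡ b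
  from refl = ⊕-cancelˡ a b

eqV-disjoint : ∀ {x y : Vec Bool n} (v : Vec Bool n) → x ≢ y → eqV v x ∧ eqV v y ≡ false
eqV-disjoint {x = x} {y} v x≢y with ≡-dec Bool._≟_ v x
... | yes refl = eqV-≢ x≢y
... | no  _    = refl

-- Permutations of the coordinates

-- Coded by the position at which each successive entry is inserted; shuffles n lists all n! codes.
Shuffle : ℕ → Set
Shuffle zero    = ⊤
Shuffle (suc n) = Fin (suc n) × Shuffle n

permute : Shuffle n → Vec A n → Vec A n
permute {zero}  _       []      = []
permute {suc n} (i , π) (x ∷ v) = insertAt (permute π v) i x

shuffles : ∀ n → List (Shuffle n)
shuffles zero    = tt ∷ []
shuffles (suc n) = cartesianProduct (allFin (suc n)) (shuffles n)

length-shuffles : ∀ n → length (shuffles n) ≡ n !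
length-shuffles zero    = refl
length-shuffles (suc n) = trans (length-cartesianProduct (allFin (suc n)) (shuffles n))
  (cong₂ _*_ (length-tabulate {n = suc n} (λ i → i)) (length-shuffles n))

zipWith-insertAt : ∀ (f : A → B → X) (u : Vec A n) (v : Vec B n) i a b →
  zipWith f (insertAt u i a) (insertAt v i b) ≡ insertAt (zipWith f u v) i (f a b)
zipWith-insertAt f u       v       zero    a b = refl
zipWith-insertAt f (x ∷ u) (y ∷ v) (suc i) a b = cong (f x y ∷_) (zipWith-insertAt f u v i a b)

insertAt-replicate : ∀ (x : A) (i : Fin (suc n)) → insertAt (replicate n x) i x ≡ replicate (suc n) x
insertAt-replicate         x zero    = refl
insertAt-replicate {n = suc n} x (suc i) = cong (x ∷_) (insertAt-replicate x i)

permute-zipWith : ∀ (f : A → B → X) (π : Shuffle n) u v →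
  permute π (zipWith f u v) ≡ zipWith f (permute π u) (permute π v)
permute-zipWith {n = zero}  f π       []      []      = refl
permute-zipWith {n = suc n} f (i , π) (x ∷ u) (y ∷ v) =
  trans (cong (λ w → insertAt w i (f x y)) (permute-zipWith f π u v))
        (sym (zipWith-insertAt f (permute π u) (permute π v) i x y))

permute-replicate : ∀ (π : Shuffle n) (x : A) → permute π (replicate n x) ≡ replicate n x
permute-replicate {n = zero}  π       x = refl
permute-replicate {n = suc n} (i , π) x =
  trans (cong (λ w → insertAt w i x) (permute-replicate π x)) (insertAt-replicate x i)

permute-⨁ : ∀ (π : Shuffle n) gs → permute π (⨁ gs) ≡ ⨁ (map (permute π) gs)
permute-⨁ π []       = permute-replicate π false
permute-⨁ π (g ∷ gs) = trans (permute-zipWith _xor_ π g (⨁ gs)) (cong (permute π g ⊕_) (permute-⨁ π gs))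

count-insertAt : ∀ b (v : Vec Bool n) i c → count b (insertAt v i c) ≡ 𝟙 (does (b Bool.≟ c)) + count b v
count-insertAt b v       zero    c = refl
count-insertAt b (x ∷ v) (suc i) c = trans (cong (𝟙 (does (b Bool.≟ x)) +_) (count-insertAt b v i c))
  (+-CS.x∙yz≈y∙xz (𝟙 (does (b Bool.≟ x))) (𝟙 (does (b Bool.≟ c))) (count b v))

count-permute : ∀ b (π : Shuffle n) v → count b (permute π v) ≡ count b v
count-permute {n = zero}  b π       []      = refl
count-permute {n = suc n} b (i , π) (x ∷ v) =
  trans (count-insertAt b (permute π v) i x) (cong (𝟙 (does (b Bool.≟ x)) +_) (count-permute b π v))

count-removeAt : ∀ b (t : Vec Bool (suc n)) i →
  count b t ≡ 𝟙 (does (b Bool.≟ lookup t i)) + count b (removeAt t i)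
count-removeAt b t i =
  trans (cong (count b) (sym (insertAt-removeAt t i))) (count-insertAt b (removeAt t i) i (lookup t i))

∑-insertAt : ∀ (i : Fin (suc n)) (f : Vec Bool (suc n) → ℕ) →
  ∑[ v ∈ vertices n ] f (insertAt v i true) + ∑[ v ∈ vertices n ] f (insertAt v i false)
    ≡ ∑ (vertices (suc n)) f
∑-insertAt         zero    f = sym (∑-vertices f)
∑-insertAt {suc n} (suc i) f = begin
  ∑[ v ∈ vertices (suc n) ] f (insertAt v (suc i) true) + ∑[ v ∈ vertices (suc n) ] f (insertAt v (suc i) false)
    ≡⟨ cong₂ _+_ (∑-vertices (λ v → f (insertAt v (suc i) true)))
                 (∑-vertices (λ v → f (insertAt v (suc i) false))) ⟩
  (Tt + Ft) + (Tf + Ff)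
    ≡⟨ +-CS.interchange Tt Ft Tf Ff ⟩
  (Tt + Tf) + (Ft + Ff)
    ≡⟨ cong₂ _+_ (∑-insertAt i (f ∘ (true ∷_))) (∑-insertAt i (f ∘ (false ∷_))) ⟩
  ∑[ w ∈ vertices (suc n) ] f (true ∷ w) + ∑[ w ∈ vertices (suc n) ] f (false ∷ w)
    ≡⟨ ∑-vertices f ⟨
  ∑ (vertices (suc (suc n))) f ∎
  where
  open ≡-Reasoning
  Tt Ft Tf Ff : ℕ
  Tt = ∑[ v ∈ vertices n ] f (true ∷ insertAt v i true)
  Ft = ∑[ v ∈ vertices n ] f (false ∷ insertAt v i true)
  Tf = ∑[ v ∈ vertices n ] f (true ∷ insertAt v i false)
  Ff = ∑[ v ∈ vertices n ] f (false ∷ insertAt v i false)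

∑-permute : ∀ (π : Shuffle n) (f : Vec Bool n → ℕ) →
  ∑[ v ∈ vertices n ] f (permute π v) ≡ ∑ (vertices n) f
∑-permute {zero}  π       f = refl
∑-permute {suc n} (i , π) f = begin
  ∑ (vertices (suc n)) (λ v → f (permute (i , π) v))
    ≡⟨ ∑-vertices (λ v → f (permute (i , π) v)) ⟩
  ∑[ v ∈ vertices n ] f (insertAt (permute π v) i true) + ∑[ v ∈ vertices n ] f (insertAt (permute π v) i false)
    ≡⟨ cong₂ _+_ (∑-permute π (λ v → f (insertAt v i true)))
                 (∑-permute π (λ v → f (insertAt v i false))) ⟩
  ∑[ v ∈ vertices n ] f (insertAt v i true) + ∑[ v ∈ vertices n ] f (insertAt v i false)
    ≡⟨ ∑-insertAt i f ⟩
  ∑ (vertices (suc n)) f ∎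
  where open ≡-Reasoning

∑-permute-eqV : ∀ (π : Shuffle n) (a b : Vec Bool n) → ∑[ z ∈ vertices n ] 𝟙 (eqV (a ⊕ permute π z) b) ≡ 1
∑-permute-eqV {n} π a b = begin
  ∑[ z ∈ vertices n ] 𝟙 (eqV (a ⊕ permute π z) b)
    ≡⟨ ∑-cong (vertices n) (λ z → cong 𝟙 (eqV-⊕ a (permute π z) b)) ⟩
  ∑[ z ∈ vertices n ] 𝟙 (eqV (permute π z) (a ⊕ b))
    ≡⟨ ∑-permute π (λ z → 𝟙 (eqV z (a ⊕ b))) ⟩
  ∑[ z ∈ vertices n ] 𝟙 (eqV z (a ⊕ b))
    ≡⟨ ∑-eqV (a ⊕ b) ⟩
  1 ∎
  where open ≡-Reasoning

∑-allFin : ∀ (f : Fin (suc n) → ℕ) → ∑ (allFin (suc n)) f ≡ f zero + ∑[ i ∈ allFin n ] f (suc i)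
∑-allFin {n} f =
  cong (f zero +_) (trans (cong (λ is → ∑ is f) (sym (map-tabulate (λ i → i) suc))) (∑-map suc (allFin n) f))

∑-lookup : ∀ b (t : Vec Bool n) → ∑[ i ∈ allFin n ] 𝟙 (does (b Bool.≟ lookup t i)) ≡ count b t
∑-lookup b []      = refl
∑-lookup b (c ∷ t) = trans (∑-allFin (λ i → 𝟙 (does (b Bool.≟ lookup (c ∷ t) i))))
  (cong (𝟙 (does (b Bool.≟ c)) +_) (∑-lookup b t))

eqV-insertAt : ∀ (w : Vec Bool n) i b t →
  eqV (insertAt w i b) t ≡ does (b Bool.≟ lookup t i) ∧ eqV w (removeAt t i)
eqV-insertAt w i b t = begin
  eqV (insertAt w i b) t
    ≡⟨ eqV≡does (insertAt w i b) t ⟩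
  does (≡-dec Bool._≟_ (insertAt w i b) t)
    ≡⟨ does-⇔ (mk⇔ to from) (≡-dec Bool._≟_ (insertAt w i b) t)
                            (b Bool.≟ lookup t i ×-dec ≡-dec Bool._≟_ w (removeAt t i)) ⟩
  does (b Bool.≟ lookup t i) ∧ does (≡-dec Bool._≟_ w (removeAt t i))
    ≡⟨ cong (does (b Bool.≟ lookup t i) ∧_) (eqV≡does w (removeAt t i)) ⟨
  does (b Bool.≟ lookup t i) ∧ eqV w (removeAt t i) ∎
  where
  open ≡-Reasoning
  to : insertAt w i b ≡ t → b ≡ lookup t i × w ≡ removeAt t i
  to refl = sym (insertAt-lookup w i b) , sym (removeAt-insertAt w i b)
  from : b ≡ lookup t i × w ≡ removeAt t i → insertAt w i b ≡ t
  from (refl , refl) = insertAt-removeAt t i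

∑-eqV-insertAt : ∀ (g : Vec Bool n) i b t →
  ∑[ π ∈ shuffles n ] 𝟙 (eqV (insertAt (permute π g) i b) t)
    ≡ 𝟙 (does (b Bool.≟ lookup t i)) * ∑[ π ∈ shuffles n ] 𝟙 (eqV (permute π g) (removeAt t i))
∑-eqV-insertAt {n} g i b t = begin
  ∑[ π ∈ shuffles n ] 𝟙 (eqV (insertAt (permute π g) i b) t)
    ≡⟨ ∑-cong (shuffles n) (λ π → trans (cong 𝟙 (eqV-insertAt (permute π g) i b t)) (𝟙-∧ b≡tᵢ _)) ⟩
  ∑[ π ∈ shuffles n ] (𝟙 b≡tᵢ * 𝟙 (eqV (permute π g) (removeAt t i)))
    ≡⟨ ∑-distribˡ-* (shuffles n) (𝟙 b≡tᵢ) (λ π → 𝟙 (eqV (permute π g) (removeAt t i))) ⟩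
  𝟙 b≡tᵢ * ∑[ π ∈ shuffles n ] 𝟙 (eqV (permute π g) (removeAt t i)) ∎
  where
  open ≡-Reasoning
  b≡tᵢ : Bool
  b≡tᵢ = does (b Bool.≟ lookup t i)

∑-shuffles-onto : ∀ (g t : Vec Bool n) → (∀ b → count b g ≡ count b t) →
  ∑[ π ∈ shuffles n ] 𝟙 (eqV (permute π g) t) ≡ count true g ! * count false g !
∑-shuffles-onto         []      []      _          = refl
∑-shuffles-onto {suc n} (b ∷ g) t       same-count = begin
  ∑ (cartesianProduct (allFin (suc n)) (shuffles n)) (λ π → 𝟙 (eqV (permute π (b ∷ g)) t))
    ≡⟨ ∑-cartesianProduct (allFin (suc n)) (shuffles n) _ ⟩
  ∑[ i ∈ allFin (suc n) ] ∑[ π ∈ shuffles n ] 𝟙 (eqV (insertAt (permute π g) i b) t)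
    ≡⟨ ∑-cong (allFin (suc n)) (λ i → trans (∑-eqV-insertAt g i b t) (restricted i (b Bool.≟ lookup t i))) ⟩
  ∑[ i ∈ allFin (suc n) ] (F * 𝟙 (does (b Bool.≟ lookup t i)))
    ≡⟨ ∑-distribˡ-* (allFin (suc n)) F _ ⟩
  F * ∑[ i ∈ allFin (suc n) ] 𝟙 (does (b Bool.≟ lookup t i))
    ≡⟨ cong (F *_) (trans (∑-lookup b t) (sym (same-count b))) ⟩
  F * count b (b ∷ g)
    ≡⟨ factorials b ⟩
  count true (b ∷ g) ! * count false (b ∷ g) ! ∎
  where
  open ≡-Reasoning
  F : ℕ
  F = count true g ! * count false g !
  restricted : ∀ i (b≟tᵢ : Dec (b ≡ lookup t i)) →
    𝟙 (does b≟tᵢ) * ∑[ π ∈ shuffles n ] 𝟙 (eqV (permute π g) (removeAt t i)) ≡ F * 𝟙 (does b≟tᵢ)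
  restricted i (no _)     = sym (*-zeroʳ F)
  restricted i (yes refl) =
    trans (+-identityʳ _) (trans (∑-shuffles-onto g (removeAt t i) same-count′) (sym (*-identityʳ F)))
    where
    same-count′ : ∀ c → count c g ≡ count c (removeAt t i)
    same-count′ c = +-cancelˡ-≡ (𝟙 (does (c Bool.≟ b))) (count c g) (count c (removeAt t i))
      (trans (same-count c) (count-removeAt c t i))
  factorials : ∀ b → F * count b (b ∷ g) ≡ count true (b ∷ g) ! * count false (b ∷ g) !
  factorials true  = trans (*-comm F (suc (count true g)))
    (sym (*-assoc (suc (count true g)) (count true g !) (count false g !)))
  factorials false = trans (*-comm F (suc (count false g)))
    (*-CS.x∙yz≈y∙xz (suc (count false g)) (count true g !) (count false g !))

module LoopErasure {A : Set} (_≟_ : DecidableEquality A) where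

  open import Data.List.Membership.DecPropositional _≟_ using (_∈_; _∈?_)

  suffixFrom : ∀ {x : A} {ys} → x ∈ ys → List A
  suffixFrom {ys = y ∷ ys} (here _)  = y ∷ ys
  suffixFrom {ys = y ∷ ys} (there p) = suffixFrom p

  -- If x already occurs in ys, the loop from x back to that occurrence is cut out.
  prepend : A → List A → List A
  prepend x ys with x ∈? ys
  ... | yes x∈ = suffixFrom x∈
  ... | no  _  = x ∷ ys

  eraseLoops : List A → List A
  eraseLoops []       = []
  eraseLoops (x ∷ xs) = prepend x (eraseLoops xs)

  suffixFrom-head : ∀ {x : A} {ys} (p : x ∈ ys) → head (suffixFrom p) ≡ just x
  suffixFrom-head (here refl) = refl
  suffixFrom-head (there p)   = suffixFrom-head p

  suffixFrom-last : ∀ {x : A} {ys} (p : x ∈ ys) → last (suffixFrom p) ≡ last ys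
  suffixFrom-last                  (here _)  = refl
  suffixFrom-last {ys = _ ∷ _ ∷ _} (there p) = suffixFrom-last p

  suffixFrom-linked : ∀ {R : A → A → Set} {x : A} {ys} (p : x ∈ ys) → Linked R ys → Linked R (suffixFrom p)
  suffixFrom-linked (here _)  R-ys = R-ys
  suffixFrom-linked (there p) R-ys = suffixFrom-linked p (Linked.tail R-ys)

  suffixFrom-unique : ∀ {x : A} {ys} (p : x ∈ ys) → Unique ys → Unique (suffixFrom p)
  suffixFrom-unique (here _)  u-ys       = u-ys
  suffixFrom-unique (there p) (_ ∷ u-ys) = suffixFrom-unique p u-ys

  prepend-head : ∀ x ys → head (prepend x ys) ≡ just x
  prepend-head x ys with x ∈? ys
  ... | yes x∈ = suffixFrom-head x∈
  ... | no  _  = refl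

  prepend-last : ∀ x ys → last (prepend x ys) ≡ last (x ∷ ys)
  prepend-last x []       = refl
  prepend-last x (y ∷ ys) with x ∈? y ∷ ys
  ... | yes x∈ = suffixFrom-last x∈
  ... | no  _  = refl

  prepend-linked : ∀ {R : A → A → Set} {x ys} →
    Connected R (just x) (head ys) → Linked R ys → Linked R (prepend x ys)
  prepend-linked {x = x} {ys} Rxy R-ys with x ∈? ys
  ... | yes x∈ = suffixFrom-linked x∈ R-ys
  ... | no  _  = Rxy ∷′ R-ys

  prepend-unique : ∀ x {ys} → Unique ys → Unique (prepend x ys)
  prepend-unique x {ys} u-ys with x ∈? ys
  ... | yes x∈ = suffixFrom-unique x∈ u-ys
  ... | no  x∉ = ¬Any⇒All¬ ys x∉ ∷ u-ys

  eraseLoops-head : ∀ xs → head (eraseLoops xs) ≡ head xs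
  eraseLoops-head []       = refl
  eraseLoops-head (x ∷ xs) = prepend-head x (eraseLoops xs)

  eraseLoops-last : ∀ xs → last (eraseLoops xs) ≡ last xs
  eraseLoops-last []       = refl
  eraseLoops-last (x ∷ xs) = trans (prepend-last x (eraseLoops xs))
    (last-∷ (eraseLoops xs) xs (eraseLoops-head xs) (eraseLoops-last xs))
    where
    last-∷ : ∀ ys zs → head ys ≡ head zs → last ys ≡ last zs → last (x ∷ ys) ≡ last (x ∷ zs)
    last-∷ []      []      _ _     = refl
    last-∷ (_ ∷ _) (_ ∷ _) _ ys≡zs = ys≡zs

  eraseLoops-linked : ∀ {R : A → A → Set} {xs} → Linked R xs → Linked R (eraseLoops xs)
  eraseLoops-linked {xs = []}     R-xs = []
  eraseLoops-linked {xs = x ∷ xs} R-xs = prepend-linked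
    (subst (Connected _ (just x)) (sym (eraseLoops-head xs)) (Linked.head′ R-xs))
    (eraseLoops-linked (Linked.tail R-xs))

  eraseLoops-unique : ∀ xs → Unique (eraseLoops xs)
  eraseLoops-unique []       = []
  eraseLoops-unique (x ∷ xs) = prepend-unique x (eraseLoops-unique xs)

module VertexLoopErasure {n : ℕ} = LoopErasure (≡-dec {n = n} Bool._≟_)
open VertexLoopErasure using (eraseLoops; eraseLoops-head; eraseLoops-last; eraseLoops-linked; eraseLoops-unique)

-- Walks

traverses : (u v a b : Vertex n) → Bool
traverses u v a b = (eqV a u ∧ eqV b v) ∨ (eqV a v ∧ eqV b u)

avoids⇒linked : ∀ (u v : Vertex n) P →
  usesEdge u v P ≡ false → Linked (λ a b → traverses u v a b ≡ false) P
avoids⇒linked u v []          _ = []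
avoids⇒linked u v (a ∷ [])    _ = [-]
avoids⇒linked u v (a ∷ b ∷ P) h =
  Boolₚ.∨-conicalˡ _ _ h ∷ avoids⇒linked u v (b ∷ P) (Boolₚ.∨-conicalʳ (traverses u v a b) _ h)

linked⇒avoids : ∀ (u v : Vertex n) {P} →
  Linked (λ a b → traverses u v a b ≡ false) P → usesEdge u v P ≡ false
linked⇒avoids u v []         = refl
linked⇒avoids u v [-]        = refl
linked⇒avoids u v (ab ∷ avs) = cong₂ _∨_ ab (linked⇒avoids u v avs)

usesEdge-eraseLoops : ∀ (u v : Vertex n) P → 𝟙 (usesEdge u v (eraseLoops P)) ≤ 𝟙 (usesEdge u v P)
usesEdge-eraseLoops u v P with usesEdge u v P in avoids
... | true  = 𝟙≤1 _
... | false = ≤-reflexive (cong 𝟙 (linked⇒avoids u v (eraseLoops-linked (avoids⇒linked u v P avoids))))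

steps : Vec Bool n → List (Vec Bool n) → List (Vec Bool n)
steps x []       = []
steps x (g ∷ gs) = x ⊕ g ∷ steps (x ⊕ g) gs

walk : Vec Bool n → List (Vec Bool n) → List (Vec Bool n)
walk x gs = x ∷ steps x gs

walk-last : ∀ (x : Vec Bool n) gs → last (walk x gs) ≡ just (x ⊕ ⨁ gs)
walk-last x []       = cong just (sym (⊕-identityʳ x))
walk-last x (g ∷ gs) = trans (walk-last (x ⊕ g) gs) (cong just (⊕-assoc x g (⨁ gs)))

walk-linked : ∀ {d} (x : Vec Bool n) {gs} → All (λ g → wt g ≡ d) gs → Linked (Adj d) (walk x gs)
walk-linked x []                   = [-]
walk-linked x {g ∷ _} (wg ∷ wgs) =
  trans (hamming≡wt⊕ x (x ⊕ g)) (trans (cong wt (⊕-cancelˡ x g)) wg) ∷ walk-linked (x ⊕ g) wgs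

crossings : (u v : Vertex n) → Vec Bool n → List (Vec Bool n) → ℕ
crossings u v x []       = 0
crossings u v x (g ∷ gs) = 𝟙 (traverses u v x (x ⊕ g)) + crossings u v (x ⊕ g) gs

usesEdge-walk : ∀ (u v x : Vertex n) gs → 𝟙 (usesEdge u v (walk x gs)) ≤ crossings u v x gs
usesEdge-walk u v x []       = z≤n
usesEdge-walk u v x (g ∷ gs) = ≤-trans (𝟙-∨ (traverses u v x (x ⊕ g)) _)
  (+-monoʳ-≤ (𝟙 (traverses u v x (x ⊕ g))) (usesEdge-walk u v (x ⊕ g) gs))

∑-traverses : ∀ (u v g : Vertex n) →
  ∑[ x ∈ vertices n ] 𝟙 (traverses u v x (x ⊕ g)) ≤ 2 * 𝟙 (eqV g (u ⊕ v))
∑-traverses {n} u v g = begin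
  ∑[ x ∈ vertices n ] 𝟙 (traverses u v x (x ⊕ g))
    ≤⟨ ∑-mono-≤ (vertices n) (λ x → ≤-trans (𝟙-∨ (eqV x u ∧ eqV (x ⊕ g) v) _)
                                    (≤-reflexive (cong₂ _+_ (𝟙-∧ (eqV x u) _) (𝟙-∧ (eqV x v) _)))) ⟩
  ∑[ x ∈ vertices n ] (𝟙 (eqV x u) * 𝟙 (eqV (x ⊕ g) v) + 𝟙 (eqV x v) * 𝟙 (eqV (x ⊕ g) u))
    ≡⟨ ∑-distrib-+ (vertices n) (λ x → 𝟙 (eqV x u) * 𝟙 (eqV (x ⊕ g) v)) _ ⟩
  ∑[ x ∈ vertices n ] (𝟙 (eqV x u) * 𝟙 (eqV (x ⊕ g) v))
    + ∑[ x ∈ vertices n ] (𝟙 (eqV x v) * 𝟙 (eqV (x ⊕ g) u))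
    ≡⟨ cong₂ _+_ (∑-pick u (λ x → 𝟙 (eqV (x ⊕ g) v))) (∑-pick v (λ x → 𝟙 (eqV (x ⊕ g) u))) ⟩
  𝟙 (eqV (u ⊕ g) v) + 𝟙 (eqV (v ⊕ g) u)
    ≡⟨ cong₂ _+_ (cong 𝟙 (eqV-⊕ u g v)) (cong 𝟙 (trans (eqV-⊕ v g u) (cong (eqV g) (⊕-comm v u)))) ⟩
  𝟙 (eqV g (u ⊕ v)) + 𝟙 (eqV g (u ⊕ v))
    ≡⟨ cong (𝟙 (eqV g (u ⊕ v)) +_) (+-identityʳ _) ⟨
  2 * 𝟙 (eqV g (u ⊕ v)) ∎
  where open ≤-Reasoning

∑-crossings : ∀ (u v : Vertex n) gs →
  ∑[ x ∈ vertices n ] crossings u v x gs ≤ 2 * ∑[ g ∈ gs ] 𝟙 (eqV g (u ⊕ v))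
∑-crossings {n} u v []       = ≤-reflexive (∑-zero (vertices n))
∑-crossings {n} u v (g ∷ gs) = begin
  ∑[ x ∈ vertices n ] (𝟙 (traverses u v x (x ⊕ g)) + crossings u v (x ⊕ g) gs)
    ≡⟨ ∑-distrib-+ (vertices n) (λ x → 𝟙 (traverses u v x (x ⊕ g))) _ ⟩
  ∑[ x ∈ vertices n ] 𝟙 (traverses u v x (x ⊕ g)) + ∑[ x ∈ vertices n ] crossings u v (x ⊕ g) gs
    ≡⟨ cong (_ +_) (∑-translate g (λ y → crossings u v y gs)) ⟩
  ∑[ x ∈ vertices n ] 𝟙 (traverses u v x (x ⊕ g)) + ∑[ x ∈ vertices n ] crossings u v x gs
    ≤⟨ +-mono-≤ (∑-traverses u v g) (∑-crossings u v gs) ⟩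
  2 * 𝟙 (eqV g (u ⊕ v)) + 2 * ∑[ h ∈ gs ] 𝟙 (eqV h (u ⊕ v))
    ≡⟨ *-distribˡ-+ 2 (𝟙 (eqV g (u ⊕ v))) _ ⟨
  2 * ∑ (g ∷ gs) (λ h → 𝟙 (eqV h (u ⊕ v))) ∎
  where open ≤-Reasoning

IsPath⁺ : ∀ {d} {x : Vertex n} P → head P ≡ just x → Linked (Adj d) P → Unique P → IsPath d P
IsPath⁺ (_ ∷ _) _ linked unique = linked , unique

endsAt⁺ : ∀ (a b : Vertex n) {x y} P → head P ≡ just x → last P ≡ just y →
  endsAt a b P ≡ (eqV x a ∧ eqV y b) ∨ (eqV x b ∧ eqV y a)
endsAt⁺ a b P hP lP rewrite hP | lP = refl

module Routes {n d : ℕ} (0<d : 0 < d) (d<n : d < n) (d-odd : parity d ≡ 1ℙ) where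

  open Words 0<d d<n d-odd using (word)

  wordOf : (z : Vec Bool n) → Word d z
  wordOf z = proj₁ (word z)

  generators : Shuffle n → Vec Bool n → List (Vec Bool n)
  generators π z = map (permute π) (letters (wordOf z))

  route : Vec Bool n → Shuffle n → Vec Bool n → List (Vec Bool n)
  route x π z = eraseLoops (walk x (generators π z))

  triples : List (Vec Bool n × Shuffle n × Vec Bool n)
  triples = cartesianProduct (vertices n) (cartesianProduct (shuffles n) (vertices n))

  routes : List (List (Vec Bool n))
  routes = map (λ (x , π , z) → route x π z) triples

  ∑-routes : ∀ f →
    ∑ routes f ≡ ∑[ x ∈ vertices n ] ∑[ π ∈ shuffles n ] ∑[ z ∈ vertices n ] f (route x π z)
  ∑-routes f = trans (∑-map _ triples f)
    (trans (∑-cartesianProduct (vertices n) _ _)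
           (∑-cong (vertices n) (λ x → ∑-cartesianProduct (shuffles n) (vertices n) _)))

  generators-wt : ∀ π z → All (λ g → wt g ≡ d) (generators π z)
  generators-wt π z = map⁺ (All.map (λ {g} wg → trans (count-permute true π g) wg) (letters-wt (wordOf z)))

  route-isPath : ∀ x π z → IsPath d (route x π z)
  route-isPath x π z = IsPath⁺ (route x π z)
    (eraseLoops-head (walk x (generators π z)))
    (eraseLoops-linked (walk-linked x (generators-wt π z)))
    (eraseLoops-unique (walk x (generators π z)))

  routes-arePaths : All (IsPath d) routes
  routes-arePaths = map⁺ (All.tabulate (λ { {x , π , z} _ → route-isPath x π z }))

  route-last : ∀ x π z → last (route x π z) ≡ just (x ⊕ permute π z)
  route-last x π z = begin
    last (route x π z)
      ≡⟨ eraseLoops-last (walk x (generators π z)) ⟩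
    last (walk x (generators π z))
      ≡⟨ walk-last x (generators π z) ⟩
    just (x ⊕ ⨁ (generators π z))
      ≡⟨ cong (λ y → just (x ⊕ y)) (permute-⨁ π (letters (wordOf z))) ⟨
    just (x ⊕ permute π (⨁ (letters (wordOf z))))
      ≡⟨ cong (λ y → just (x ⊕ permute π y)) (⨁-letters (wordOf z)) ⟩
    just (x ⊕ permute π z) ∎
    where open ≡-Reasoning

  ∑-endsAt : ∀ {a b : Vertex n} → a ≢ b → ∑ routes (𝟙 ∘ endsAt a b) ≡ 2 * n !
  ∑-endsAt {a} {b} a≢b = begin
    ∑ routes (𝟙 ∘ endsAt a b)
      ≡⟨ ∑-routes (𝟙 ∘ endsAt a b) ⟩
    ∑[ x ∈ vertices n ] ∑[ π ∈ shuffles n ] ∑[ z ∈ vertices n ] 𝟙 (endsAt a b (route x π z))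
      ≡⟨ ∑-cong (vertices n) (λ x → ∑-cong (shuffles n) (λ π → ∑-cong (vertices n) (ends x π))) ⟩
    ∑[ x ∈ vertices n ] ∑[ π ∈ shuffles n ] ∑[ z ∈ vertices n ] E x π z
      ≡⟨ ∑-rotate (vertices n) (shuffles n) (vertices n) E ⟩
    ∑[ π ∈ shuffles n ] ∑[ z ∈ vertices n ] ∑[ x ∈ vertices n ] E x π z
      ≡⟨ ∑-cong (shuffles n) (λ π → ∑-cong (vertices n) (λ z → starts π z)) ⟩
    ∑[ π ∈ shuffles n ] ∑[ z ∈ vertices n ] (𝟙 (eqV (a ⊕ permute π z) b) + 𝟙 (eqV (b ⊕ permute π z) a))
      ≡⟨ ∑-cong (shuffles n) (λ π → trans (∑-distrib-+ (vertices n) _ _)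
                                          (cong₂ _+_ (∑-permute-eqV π a b) (∑-permute-eqV π b a))) ⟩
    ∑[ π ∈ shuffles n ] 2
      ≡⟨ trans (∑-const (shuffles n) 2) (trans (cong (_* 2) (length-shuffles n)) (*-comm (n !) 2)) ⟩
    2 * n ! ∎
    where
    open ≡-Reasoning
    E : Vertex n → Shuffle n → Vertex n → ℕ
    E x π z = 𝟙 (eqV x a) * 𝟙 (eqV (x ⊕ permute π z) b) + 𝟙 (eqV x b) * 𝟙 (eqV (x ⊕ permute π z) a)
    ends : ∀ x π z → 𝟙 (endsAt a b (route x π z)) ≡ E x π z
    ends x π z = trans
      (cong 𝟙 (endsAt⁺ a b (route x π z) (eraseLoops-head (walk x (generators π z))) (route-last x π z)))
      (𝟙-∨-∧ (eqV x a) _ (eqV x b) _ (eqV-disjoint x a≢b))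
    starts : ∀ π z → ∑[ x ∈ vertices n ] E x π z ≡ 𝟙 (eqV (a ⊕ permute π z) b) + 𝟙 (eqV (b ⊕ permute π z) a)
    starts π z = trans (∑-distrib-+ (vertices n) _ _)
      (cong₂ _+_ (∑-pick a (λ x → 𝟙 (eqV (x ⊕ permute π z) b)))
                 (∑-pick b (λ x → 𝟙 (eqV (x ⊕ permute π z) a))))

  ∑-stabilisers : ∀ {t : Vertex n} → wt t ≡ d → ∀ {gs} → All (λ g → wt g ≡ d) gs →
    ∑[ g ∈ gs ] ∑[ π ∈ shuffles n ] 𝟙 (eqV (permute π g) t) ≡ length gs * (d ! * (n ∸ d) !)
  ∑-stabilisers wt≡d []                   = refl
  ∑-stabilisers {t} wt≡d {g ∷ _} (wg ∷ wgs) = cong₂ _+_ stabiliser (∑-stabilisers wt≡d wgs)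
    where
    same-count : ∀ b → count b g ≡ count b t
    same-count true  = trans wg (sym wt≡d)
    same-count false =
      trans (count-false≡n∸wt g) (trans (cong (n ∸_) (trans wg (sym wt≡d))) (sym (count-false≡n∸wt t)))
    stabiliser : ∑[ π ∈ shuffles n ] 𝟙 (eqV (permute π g) t) ≡ d ! * (n ∸ d) !
    stabiliser = trans (∑-shuffles-onto g t same-count)
      (cong₂ (λ k l → k ! * l !) wg (trans (count-false≡n∸wt g) (cong (n ∸_) wg)))

  ∑-usesEdge-route : ∀ (u v : Vertex n) π z →
    ∑[ x ∈ vertices n ] 𝟙 (usesEdge u v (route x π z)) ≤ 2 * ∑[ g ∈ generators π z ] 𝟙 (eqV g (u ⊕ v))
  ∑-usesEdge-route u v π z = ≤-trans
    (∑-mono-≤ (vertices n) (λ x → ≤-trans (usesEdge-eraseLoops u v (walk x (generators π z)))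
                                          (usesEdge-walk u v x (generators π z))))
    (∑-crossings u v (generators π z))

  ∑-generators-eqV : ∀ {t : Vertex n} → wt t ≡ d →
    ∑[ π ∈ shuffles n ] ∑[ z ∈ vertices n ] ∑[ g ∈ generators π z ] 𝟙 (eqV g t)
      ≤ 2 ^ n * (n * (d ! * (n ∸ d) !))
  ∑-generators-eqV {t} wt≡d = begin
    ∑[ π ∈ shuffles n ] ∑[ z ∈ vertices n ] ∑[ g ∈ generators π z ] 𝟙 (eqV g t)
      ≡⟨ ∑-cong (shuffles n) (λ π → ∑-cong (vertices n) (λ z → ∑-map (permute π) (letters (wordOf z)) _)) ⟩
    ∑[ π ∈ shuffles n ] ∑[ z ∈ vertices n ] ∑[ g ∈ letters (wordOf z) ] 𝟙 (eqV (permute π g) t)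
      ≡⟨ trans (∑-comm (shuffles n) (vertices n) _)
               (∑-cong (vertices n) (λ z → ∑-comm (shuffles n) (letters (wordOf z)) _)) ⟩
    ∑[ z ∈ vertices n ] ∑[ g ∈ letters (wordOf z) ] ∑[ π ∈ shuffles n ] 𝟙 (eqV (permute π g) t)
      ≡⟨ ∑-cong (vertices n) (λ z → ∑-stabilisers wt≡d (letters-wt (wordOf z))) ⟩
    ∑[ z ∈ vertices n ] (length (letters (wordOf z)) * K)
      ≤⟨ ∑-mono-≤ (vertices n) (λ z → *-monoˡ-≤ K (proj₂ (word z))) ⟩
    ∑[ z ∈ vertices n ] (n * K)
      ≡⟨ trans (∑-const (vertices n) (n * K)) (cong (_* (n * K)) (length-vertices n)) ⟩
    2 ^ n * (n * K) ∎
    where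
    open ≤-Reasoning
    K : ℕ
    K = d ! * (n ∸ d) !

  ∑-usesEdge : ∀ {u v : Vertex n} → Adj d u v →
    ∑ routes (𝟙 ∘ usesEdge u v) ≤ 2 * (2 ^ n * (n * (d ! * (n ∸ d) !)))
  ∑-usesEdge {u} {v} huv = begin
    ∑ routes (𝟙 ∘ usesEdge u v)
      ≡⟨ ∑-routes (𝟙 ∘ usesEdge u v) ⟩
    ∑[ x ∈ vertices n ] ∑[ π ∈ shuffles n ] ∑[ z ∈ vertices n ] 𝟙 (usesEdge u v (route x π z))
      ≡⟨ ∑-rotate (vertices n) (shuffles n) (vertices n) (λ x π z → 𝟙 (usesEdge u v (route x π z))) ⟩
    ∑[ π ∈ shuffles n ] ∑[ z ∈ vertices n ] ∑[ x ∈ vertices n ] 𝟙 (usesEdge u v (route x π z))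
      ≤⟨ ∑-mono-≤ (shuffles n) (λ π → ∑-mono-≤ (vertices n) (∑-usesEdge-route u v π)) ⟩
    ∑[ π ∈ shuffles n ] ∑[ z ∈ vertices n ] (2 * ∑[ g ∈ generators π z ] 𝟙 (eqV g (u ⊕ v)))
      ≡⟨ trans (∑-cong (shuffles n) (λ π → ∑-distribˡ-* (vertices n) 2 _)) (∑-distribˡ-* (shuffles n) 2 _) ⟩
    2 * ∑[ π ∈ shuffles n ] ∑[ z ∈ vertices n ] ∑[ g ∈ generators π z ] 𝟙 (eqV g (u ⊕ v))
      ≤⟨ *-monoʳ-≤ 2 (∑-generators-eqV (trans (sym (hamming≡wt⊕ u v)) huv)) ⟩
    2 * (2 ^ n * (n * (d ! * (n ∸ d) !))) ∎
    where open ≤-Reasoning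

toℚᵘ-/ : ∀ a m → toℚᵘ (ℤ.+ a / suc m) ℚᵘ.≃ mkℚᵘ (ℤ.+ a) m
toℚᵘ-/ a m = toℚᵘ-fromℚᵘ (mkℚᵘ (ℤ.+ a) m)

/-≡ : ∀ {a b m l} → a * suc l ≡ b * suc m → ℤ.+ a / suc m ≡ ℤ.+ b / suc l
/-≡ {a} {b} {m} {l} eq = toℚᵘ-injective (begin
  toℚᵘ (ℤ.+ a / suc m) ≈⟨ toℚᵘ-/ a m ⟩
  mkℚᵘ (ℤ.+ a) m       ≈⟨ *≡* (trans (sym (pos-* a (suc l))) (trans (cong ℤ.+_ eq) (pos-* b (suc m)))) ⟩
  mkℚᵘ (ℤ.+ b) l       ≈⟨ toℚᵘ-/ b l ⟨
  toℚᵘ (ℤ.+ b / suc l) ∎)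
  where open ℚᵘₚ.≃-Reasoning

/-≤ : ∀ {a b m l} → a * suc l ≤ b * suc m → ℤ.+ a / suc m ≤ℚ ℤ.+ b / suc l
/-≤ {a} {b} {m} {l} le = toℚᵘ-cancel-≤
  (ℚᵘₚ.≤-respˡ-≃ (ℚᵘₚ.≃-sym (toℚᵘ-/ a m)) (ℚᵘₚ.≤-respʳ-≃ (ℚᵘₚ.≃-sym (toℚᵘ-/ b l))
    (*≤* (subst₂ ℤ._≤_ (pos-* a (suc l)) (pos-* b (suc m)) (+≤+ le)))))

+-common-denominator : ∀ a b D →
  (ℤ.+ a ℤ.* ℤ.+ D ℤ.+ ℤ.+ b ℤ.* ℤ.+ D) ℤ.* ℤ.+ D ≡ ℤ.+ (a + b) ℤ.* ℤ.+ (D * D)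
+-common-denominator a b D = begin
  (ℤ.+ a ℤ.* ℤ.+ D ℤ.+ ℤ.+ b ℤ.* ℤ.+ D) ℤ.* ℤ.+ D
    ≡⟨ cong (ℤ._* ℤ.+ D) (cong₂ ℤ._+_ (pos-* a D) (pos-* b D)) ⟨
  (ℤ.+ (a * D) ℤ.+ ℤ.+ (b * D)) ℤ.* ℤ.+ D
    ≡⟨ cong (ℤ._* ℤ.+ D) (pos-+ (a * D) (b * D)) ⟨
  ℤ.+ (a * D + b * D) ℤ.* ℤ.+ D
    ≡⟨ pos-* (a * D + b * D) D ⟨
  ℤ.+ ((a * D + b * D) * D)
    ≡⟨ cong ℤ.+_ (trans (cong (_* D) (sym (*-distribʳ-+ D a b))) (*-assoc (a + b) D D)) ⟩
  ℤ.+ ((a + b) * (D * D))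
    ≡⟨ pos-* (a + b) (D * D) ⟩
  ℤ.+ (a + b) ℤ.* ℤ.+ (D * D) ∎
  where open ≡-Reasoning

/-+ : ∀ a b m → ℤ.+ a / suc m +ℚ ℤ.+ b / suc m ≡ ℤ.+ (a + b) / suc m
/-+ a b m = toℚᵘ-injective (begin
  toℚᵘ (ℤ.+ a / suc m +ℚ ℤ.+ b / suc m)          ≈⟨ toℚᵘ-homo-+ (ℤ.+ a / suc m) (ℤ.+ b / suc m) ⟩
  toℚᵘ (ℤ.+ a / suc m) ℚᵘ.+ toℚᵘ (ℤ.+ b / suc m) ≈⟨ ℚᵘₚ.+-cong (toℚᵘ-/ a m) (toℚᵘ-/ b m) ⟩
  mkℚᵘ (ℤ.+ a) m ℚᵘ.+ mkℚᵘ (ℤ.+ b) m              ≈⟨ *≡* (+-common-denominator a b (suc m)) ⟩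
  mkℚᵘ (ℤ.+ (a + b)) m                            ≈⟨ toℚᵘ-/ (a + b) m ⟨
  toℚᵘ (ℤ.+ (a + b) / suc m)                      ∎)
  where open ℚᵘₚ.≃-Reasoning

weightOf-uniform : ∀ (p : List (Vertex n) → Bool) Ps m →
  weightOf p (map (λ P → P , ℤ.+ 1 / suc m) Ps) ≡ ℤ.+ ∑ Ps (𝟙 ∘ p) / suc m
weightOf-uniform p []       m = sym (0/n≡0 (suc m))
weightOf-uniform p (P ∷ Ps) m with p P
... | true  = trans (cong (ℤ.+ 1 / suc m +ℚ_) (weightOf-uniform p Ps m)) (/-+ 1 (∑ Ps (𝟙 ∘ p)) m)
... | false = trans (ℚₚ.+-identityˡ _) (weightOf-uniform p Ps m)

%2≡1⇒parity≡1ℙ : ∀ d → d % 2 ≡ 1 → parity d ≡ 1ℙ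
%2≡1⇒parity≡1ℙ (suc zero)    _ = refl
%2≡1⇒parity≡1ℙ (suc (suc d)) h = %2≡1⇒parity≡1ℙ d h

nCk*k!*[n∸k]!≡n! : ∀ {n k} → k ≤ n → (n C k) * (k ! * (n ∸ k) !) ≡ n !
nCk*k!*[n∸k]!≡n! {n} {k} k≤n = trans (cong (_* (k ! * (n ∸ k) !)) (nCk≡n!/k![n-k]! k≤n))
  (m/n*n≡m {{k !* (n ∸ k) !≢0}} (k![n∸k]!∣n! k≤n))

congestion-fraction : ∀ {n c C K m} → C * K ≡ n ! → 2 * n ! ≡ suc m →
  c ≤ 2 * (2 ^ n * (n * K)) → ℤ.+ c / suc m ≤ℚ (n * 2 ^ n) /ℕ C
congestion-fraction {n} {C = zero}          CK≡n! _      _  = ⊥-elim (<⇒≢ (1≤n! n) CK≡n!)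
congestion-fraction {n} {c} {suc b} {K} {m} CK≡n! 2n!≡N c≤ = /-≤ {c} {n * 2 ^ n} {m} {b} (begin
  c * suc b                         ≤⟨ *-monoˡ-≤ (suc b) c≤ ⟩
  2 * (2 ^ n * (n * K)) * suc b     ≡⟨ regroup (2 ^ n) n K (suc b) ⟩
  n * 2 ^ n * (2 * (suc b * K))     ≡⟨ cong (λ k → n * 2 ^ n * (2 * k)) CK≡n! ⟩
  n * 2 ^ n * (2 * n !)             ≡⟨ cong (n * 2 ^ n *_) 2n!≡N ⟩
  n * 2 ^ n * suc m                 ∎)
  where
  open ≤-Reasoning
  regroup : ∀ p n k c → 2 * (p * (n * k)) * c ≡ n * p * (2 * (c * k))
  regroup = solve-∀

lemma3p1 : ∀ (n d : ℕ) → 0 < d → d < n → d % 2 ≡ 1 →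
    Σ (Flow n) (λ φ → IsAFlow d φ × CngAtMost d φ ((n * 2 ^ n) /ℕ (n C d)))
lemma3p1 n d 0<d d<n d%2≡1 = φ , (valid , unit-demand) , congestion-bound
  where
  open Routes 0<d d<n (%2≡1⇒parity≡1ℙ d d%2≡1)
  m : ℕ
  m = pred (2 * n !)
  2n!≡suc-m : 2 * n ! ≡ suc m
  2n!≡suc-m = sym (suc-pred (2 * n !) {{m*n≢0 2 (n !) {{_}} {{n !≢0}}}})
  w : ℚ
  w = ℤ.+ 1 / suc m
  φ : Flow n
  φ = map (λ P → P , w) routes
  valid : All (λ e → IsPath d (proj₁ e) × 0ℚ ≤ℚ proj₂ e) φ
  valid = map⁺ (All.map (λ isPath → isPath , nonNegative⁻¹ w {{normalize-nonNeg 1 (suc m)}}) routes-arePaths)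
  unit-demand : ∀ x y → x ≢ y → weightOf (endsAt x y) φ ≡ 1ℚ
  unit-demand x y x≢y = begin
    weightOf (endsAt x y) φ               ≡⟨ weightOf-uniform (endsAt x y) routes m ⟩
    ℤ.+ ∑ routes (𝟙 ∘ endsAt x y) / suc m ≡⟨ cong (λ k → ℤ.+ k / suc m) (trans (∑-endsAt x≢y) 2n!≡suc-m) ⟩
    ℤ.+ suc m / suc m                     ≡⟨ /-≡ {suc m} {1} {m} {0} (*-comm (suc m) 1) ⟩
    1ℚ                                    ∎
    where open ≡-Reasoning
  congestion-bound : CngAtMost d φ ((n * 2 ^ n) /ℕ (n C d))
  congestion-bound u v huv = subst (_≤ℚ (n * 2 ^ n) /ℕ (n C d)) (sym (weightOf-uniform (usesEdge u v) routes m))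
    (congestion-fraction {n} {C = n C d} (nCk*k!*[n∸k]!≡n! (<⇒≤ d<n)) 2n!≡suc-m (∑-usesEdge huv))
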